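{- Let $k\ge2$, $q\ge1$. The following linear order on the facets of $T_{k,q}$ is a shelling order: for $\mathbf{a},\mathbf{b}\in\mathcal{S}_{k,q}$, $F(\mathbf{a})<F(\mathbf{b})$ if and only if either $m(\mathbf{a})<m(\mathbf{b})$; or $m(\mathbf{a})=m(\mathbf{b})$ and $S(\mathbf{a})<S(\mathbf{b})$; or $m(\mathbf{a})=m(\mathbf{b})$, $S(\mathbf{a})=S(\mathbf{b})$, and there is $i$ with $a_j=b_j$ for all $j<i$ and $a_i>b_i$.
   Context: $R_{k,q}=\{\mathbf{x}\in\mathbb{R}^{k-1}:0\le x_1\le\cdots\le x_{k-1}\le q\}$, $W_{k,q}=R_{k,q}\cap\mathbb{Z}^{k-1}$. A permutation $\pi$ of $[k-1]$ is consistent with $\mathbf{u}\in W_{k,q}$ if $i$ precedes $i+1$ in $\pi$ whenever $u_i=u_{i+1}$; then $F(\mathbf{u},\pi)$ is the simplex with vertices $\mathbf{u}^{(1)}=\mathbf{u}$, $\mathbf{u}^{(m+1)}=\mathbf{u}^{(m)}+e_{\pi_{k-m}}$ ($m=1,\ldots,k-1$). $T_{k,q}$ is the simplicial complex on $W_{k,q}$ whose facets are all such $F(\mathbf{u},\pi)$. Let $\mathcal{S}_{k,q}=\{0,1,\ldots,q-1\}^{k-1}$. For $\mathbf{a}\in\mathcal{S}_{k,q}$ let $\alpha\in\mathbb{S}_{k-1}$ be such that $a_{\alpha_1}\le a_{\alpha_2}\le\cdots\le a_{\alpha_{k-1}}$ with $\alpha_i<\alpha_{i+1}$ whenever $a_{\alpha_i}=a_{\alpha_{i+1}}$;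 put $\mathbf{v}_a=(a_{\alpha_1},\ldots,a_{\alpha_{k-1}})\in W_{k,q}$ and $F(\mathbf{a})=F(\mathbf{v}_a,\alpha^{ -1})$. The map $\mathbf{a}\mapsto F(\mathbf{a})$ is a bijection from $\mathcal{S}_{k,q}$ onto the facets of $T_{k,q}$. $m(\mathbf{a})=\max_i a_i$ and $S(\mathbf{a})=\sum_i a_i$. A shelling order of a pure complex is an ordering $F_1,\ldots,F_n$ of its facets such that for all $i<j$ there exist $l<j$ and a vertex $v$ of $F_j$ with $F_i\cap F_j\subseteq F_l\cap F_j=F_j\setminus\{v\}$. -}

module Defs where

open import Data.Nat as ℕ using (ℕ; zero; suc; _≤_; _<_; _⊔_; _+_)
open import Data.Fin as Fin using (Fin; toℕ; fromℕ<; opposite)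
open import Data.Fin.Properties using (toℕ≤pred[n])
open import Data.Nat.Properties using (<⇒≤)
open import Data.Vec using (Vec; tabulate; updateAt; foldr; sum)
open import Data.Fin.Permutation using (Permutation′; _⟨$⟩ʳ_; _⟨$⟩ˡ_; flip)
open import Data.Product using (Σ; ∃; ∃-syntax; _×_)
open import Data.Sum using (_⊎_)
open import Relation.Binary.PropositionalEquality using (_≡_; _≢_)

-- Points of ℤ^n with nonnegative coordinates (all vertices of T_{k,q} lie in
-- W_{k,q} ⊆ ℕ^{k-1}); here n = k - 1.
Point : ℕ → Set
Point n = Vec ℕ n

_+e_ : ∀ {n} → Point n → Fin n → Point n
x +e p = updateAt x p suc

-- Elements of 𝒮_{k,q} are represented as functions a : Fin n → ℕ together
-- with the bound  ∀ i → a i < q.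
InS : ∀ {n} → ℕ → (Fin n → ℕ) → Set
InS q a = ∀ i → a i < q

-- α is the (stable) sorting permutation of a: position p ↦ index α_p,
-- with a_{α_p} ≤ a_{α_{p+1}} and α_p < α_{p+1} whenever a_{α_p} = a_{α_{p+1}}.
IsSortPerm : ∀ {n} → (Fin n → ℕ) → Permutation′ n → Set
IsSortPerm {n} a α =
  (p p′ : Fin n) → toℕ p′ ≡ suc (toℕ p) →
    (a (α ⟨$⟩ʳ p) ≤ a (α ⟨$⟩ʳ p′)) ×
    (a (α ⟨$⟩ʳ p) ≡ a (α ⟨$⟩ʳ p′) → Fin._<_ (α ⟨$⟩ʳ p) (α ⟨$⟩ʳ p′))

vOf : ∀ {n} → (Fin n → ℕ) → Permutation′ n → Point n
vOf a α = tabulate (λ p → a (α ⟨$⟩ʳ p))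

-- Vertices of the simplex F(u, π):  u^(1) = u,
-- u^(m+1) = u^(m) + e_{π_{k-m}}  (m = 1, …, k-1).
-- With 0-based indices: vertex 0 = u,
-- vertex (j+1) = vertex j + e_{π (n-1-j)}  (n-1-j = opposite j).
simplexVertexℕ : ∀ {n} → Point n → Permutation′ n → (j : ℕ) → j ≤ n → Point n
simplexVertexℕ u π zero    _   = u
simplexVertexℕ u π (suc j) j<n =
  simplexVertexℕ u π j (<⇒≤ j<n) +e (π ⟨$⟩ʳ opposite (fromℕ< j<n))

simplexVertex : ∀ {n} → Point n → Permutation′ n → Fin (suc n) → Point n
simplexVertex u π j = simplexVertexℕ u π (toℕ j) (toℕ≤pred[n] j)

_∈F[_,_] : ∀ {n} → Point n → Point n → Permutation′ n → Set
_∈F[_,_] {n} x u π = ∃[ j ] x ≡ simplexVertex u π j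

_∈F_ : ∀ {n} → Point n → (Fin n → ℕ) → Set
_∈F_ {n} x a = Σ (Permutation′ n) λ α → IsSortPerm a α ×
                 (x ∈F[ vOf a α , flip α ])

mx : ∀ {n} → (Fin n → ℕ) → ℕ
mx a = foldr _ _⊔_ 0 (tabulate a)

Sm : ∀ {n} → (Fin n → ℕ) → ℕ
Sm a = sum (tabulate a)

_≺_ : ∀ {n} → (Fin n → ℕ) → (Fin n → ℕ) → Set
a ≺ b = (mx a < mx b)
      ⊎ (mx a ≡ mx b × Sm a < Sm b)
      ⊎ (mx a ≡ mx b × Sm a ≡ Sm b ×
          ∃[ i ] ((∀ j → Fin._<_ j i → a j ≡ b j) × b i < a i))

-- The shelling condition for the order ≺ on the facets F(a), a ∈ 𝒮_{k,q}
-- (facets indexed through the bijection a ↦ F(a)):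
-- for all a ≺ b there are c ≺ b and a vertex v of F(b) with
--   F(a) ∩ F(b) ⊆ F(c) ∩ F(b) = F(b) ∖ {v}.
IsShelling : ∀ {n} → ℕ → Set
IsShelling {n} q =
  (a b : Fin n → ℕ) → InS q a → InS q b → a ≺ b →
  Σ (Fin n → ℕ) λ c → InS q c × c ≺ b ×
  Σ (Point n) λ v → v ∈F b ×
    (∀ x → x ∈F a → x ∈F b → x ∈F c) ×
    (∀ x → (x ∈F c × x ∈F b → x ∈F b × x ≢ v) ×
           (x ∈F b × x ≢ v → x ∈F c × x ∈F b))

{-# OPTIONS --safe #-}
module Submission where

open import Defs
open import Data.Nat using (ℕ; _≤_; _∸_)
open import Data.Fin using (Fin)
open import Data.Product using (_×_)
open import Relation.Binary.PropositionalEquality using (_≗_)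
open import Relation.Binary.Structures using (IsStrictTotalOrder)

open import Data.Nat as ℕ using (zero; suc; _+_; _<_; _⊔_; z≤n; s≤s; >-nonZero)
open import Data.Nat.Properties
open import Data.Fin as Fin using (zero; suc; toℕ; inject₁; fromℕ<; opposite; punchIn)
import Data.Fin.Properties as Finₚ
open import Data.Fin.Induction using (<-weakInduction)
open import Data.Fin.Permutation as Perm
  using (Permutation′; _⟨$⟩ʳ_; _⟨$⟩ˡ_; flip; inverseˡ; inverseʳ)
import Data.Fin.Permutation.Components as PC
open import Data.Vec using (tabulate; lookup)
open import Data.Vec.Properties
  using (lookup∘tabulate; tabulate∘lookup; tabulate-cong; lookup∘updateAt; lookup∘updateAt′)
open import Data.Product using (Σ; ∃; ∃-syntax; _,_)
open import Data.Product.Relation.Binary.Lex.Strict using (×-Lex; ×-transitive)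
open import Data.Sum using (_⊎_; inj₁; inj₂)
open import Data.Empty using (⊥-elim)
open import Level using (0ℓ)
open import Function using (id; _∘_)
open import Relation.Nullary using (¬_; yes; no; _×-dec_)
open import Relation.Nullary.Decidable using (dec-true; dec-false)
open import Relation.Unary using (Pred; Decidable)
open import Relation.Binary using (Rel; Transitive; Trichotomous; tri<; tri≈; tri>)
open import Relation.Binary.PropositionalEquality
  using (_≡_; _≢_; refl; sym; trans; cong; cong₂; subst; subst₂; isEquivalence; resp₂; module ≡-Reasoning)
open import Algebra.Properties.CommutativeMonoid.Sum +-0-commutativeMonoid
  using (sum; sum-cong-≗; ∑-distrib-+; sum-permute)

-- Write raise b s for b with 1 added to every entry of index ≥ s.  The vertices of F(b)
-- are the vectors raise b s (s = 0, …, k − 1), sorted.  The ridge of F(b) opposite to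
-- vertex s also lies in an earlier facet F(c) when s = 0 and b₀ ≥ 1 (c is b rotated left
-- with b₀ lowered by one), or when s = i + 1 and b_i < b_{i+1} (c is b with these two
-- entries swapped).  So for a ≺ b it suffices to find such an s for which vertex s of F(b)
-- is not a vertex of F(a).  Vertices are told apart by statistics ∑_j φ(x_j), which do not
-- see the sorting: according to whether a ≺ b is decided by m, by S or lexicographically
-- (first at index i), φ = _∸ m(b), φ = _⊔ 1, or φ = _∸ a_i and φ = 1 ∸_ do the job.

Sm≡sum : ∀ {n} (a : Fin n → ℕ) → Sm a ≡ sum a
Sm≡sum {zero}  a = refl
Sm≡sum {suc n} a = cong (a zero +_) (Sm≡sum (a ∘ suc))

sum-mono-≤ : ∀ {n} {f g : Fin n → ℕ} → (∀ j → f j ≤ g j) → sum f ≤ sum g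
sum-mono-≤ {zero}  f≤g = z≤n
sum-mono-≤ {suc n} f≤g = +-mono-≤ (f≤g zero) (sum-mono-≤ (f≤g ∘ suc))

sum-mono-< : ∀ {n} {f g : Fin n → ℕ} → (∀ j → f j ≤ g j) → ∀ j → f j < g j → sum f < sum g
sum-mono-< f≤g zero    fj<gj = +-mono-<-≤ fj<gj (sum-mono-≤ (f≤g ∘ suc))
sum-mono-< f≤g (suc j) fj<gj = +-mono-≤-< (f≤g zero) (sum-mono-< (f≤g ∘ suc) j fj<gj)

sum-∘-permute : ∀ {n} (f : Fin n → ℕ) (π : Permutation′ n) → sum (f ∘ (π ⟨$⟩ʳ_)) ≡ sum f
sum-∘-permute f π = sym (sum-permute f π)

≤-mx : ∀ {n} (a : Fin n → ℕ) j → a j ≤ mx a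
≤-mx a zero    = m≤m⊔n _ _
≤-mx a (suc j) = ≤-trans (≤-mx (a ∘ suc) j) (m≤n⊔m (a zero) _)

mx-least : ∀ {n} (a : Fin n → ℕ) {M} → (∀ j → a j ≤ M) → mx a ≤ M
mx-least {zero}  a a≤M = z≤n
mx-least {suc n} a a≤M = ⊔-lub (a≤M zero) (mx-least (a ∘ suc) (a≤M ∘ suc))

mx-attained : ∀ {n} (a : Fin (suc n) → ℕ) → ∃[ j ] a j ≡ mx a
mx-attained {zero}  a = zero , sym (⊔-identityʳ (a zero))
mx-attained {suc n} a with ⊔-sel (a zero) (mx (a ∘ suc))
... | inj₁ a₀≡mx = zero , sym a₀≡mx
... | inj₂ mx′≡mx with mx-attained (a ∘ suc)
...   | j , aj≡mx′ = suc j , trans aj≡mx′ (sym mx′≡mx)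

Least : ∀ {n p} → Pred (Fin n) p → Fin n → Set p
Least P k = P k × (∀ l → toℕ l < toℕ k → ¬ P l)

least? : ∀ {n p} {P : Pred (Fin n) p} → Decidable P → ∃ (Least P) ⊎ (∀ k → ¬ P k)
least? {zero}  P? = inj₂ λ ()
least? {suc n} P? with P? zero
... | yes P₀ = inj₁ (zero , P₀ , λ _ ())
... | no ¬P₀ with least? (P? ∘ suc)
...   | inj₁ (k , Pk , below) = inj₁ (suc k , Pk , λ { zero _ → ¬P₀ ; (suc l) (s≤s l<k) → below l l<k })
...   | inj₂ none             = inj₂ λ { zero → ¬P₀ ; (suc k) → none k }

least : ∀ {n p} {P : Pred (Fin n) p} → Decidable P → ∃ P → ∃ (Least P)
least P? (k , Pk) with least? P?
... | inj₁ found = found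
... | inj₂ none  = ⊥-elim (none k Pk)

chain : ∀ {m ℓ} (R : Rel (Fin (suc m)) ℓ) → Transitive R → {lo hi : Fin (suc m)} →
        (∀ i → toℕ lo ≤ toℕ (inject₁ i) → toℕ (suc i) ≤ toℕ hi → R (inject₁ i) (suc i)) →
        toℕ lo < toℕ hi → R lo hi
chain R R-trans {zero} {suc zero} step _ = step zero z≤n ≤-refl
chain {suc m} R R-trans {zero} {suc (suc h)} step _ =
  R-trans (step zero z≤n (s≤s z≤n))
          (chain (λ x y → R (suc x) (suc y)) R-trans (λ i _ i<h → step (suc i) z≤n (s≤s i<h)) (s≤s z≤n))
chain {suc m} R R-trans {suc l} {suc h} step (s≤s l<h) =
  chain (λ x y → R (suc x) (suc y)) R-trans (λ i l≤i i<h → step (suc i) (s≤s l≤i) (s≤s i<h)) l<h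

-- Vertices of F(a) in closed form

χ[_≤_] : ℕ → ℕ → ℕ
χ[ zero  ≤ j     ] = 1
χ[ suc s ≤ zero  ] = 0
χ[ suc s ≤ suc j ] = χ[ s ≤ j ]

χ-≤ : ∀ {s j} → s ≤ j → χ[ s ≤ j ] ≡ 1
χ-≤ z≤n       = refl
χ-≤ (s≤s s≤j) = χ-≤ s≤j

χ-> : ∀ {s j} → j < s → χ[ s ≤ j ] ≡ 0
χ-> {suc s} {zero}  _         = refl
χ-> {suc s} {suc j} (s≤s j<s) = χ-> j<s

χ≤1 : ∀ s j → χ[ s ≤ j ] ≤ 1
χ≤1 zero    j       = ≤-refl
χ≤1 (suc s) zero    = z≤n
χ≤1 (suc s) (suc j) = χ≤1 s j

χ-antitone : ∀ {s s′} j → s ≤ s′ → χ[ s′ ≤ j ] ≤ χ[ s ≤ j ]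
χ-antitone {s} {s′} j s≤s′ with s′ ℕ.≤? j
... | yes s′≤j = ≤-reflexive (trans (χ-≤ s′≤j) (sym (χ-≤ (≤-trans s≤s′ s′≤j))))
... | no  s′≰j = ≤-trans (≤-reflexive (χ-> (≰⇒> s′≰j))) z≤n

χ-suc : ∀ {s j} → j ≢ s → χ[ suc s ≤ j ] ≡ χ[ s ≤ j ]
χ-suc {s} {j} j≢s with <-cmp j s
... | tri< j<s _ _ = trans (χ-> (m<n⇒m<1+n j<s)) (sym (χ-> j<s))
... | tri≈ _ j≡s _ = ⊥-elim (j≢s j≡s)
... | tri> _ _ j>s = trans (χ-≤ j>s) (sym (χ-≤ (<⇒≤ j>s)))

χ-step : ∀ {s j} → s ≢ suc j → χ[ s ≤ j ] ≡ χ[ s ≤ suc j ]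
χ-step {zero}      _       = refl
χ-step {suc s} {j} s≢1+j = χ-suc (λ j≡s → s≢1+j (cong suc (sym j≡s)))

sum-χ≡∸ : ∀ n s → sum {n} (λ j → χ[ s ≤ toℕ j ]) ≡ n ∸ s
sum-χ≡∸ zero    s       = sym (0∸n≡0 s)
sum-χ≡∸ (suc n) zero    = cong suc (sum-χ≡∸ n zero)
sum-χ≡∸ (suc n) (suc s) = sum-χ≡∸ n s

raise : ∀ {n} → (Fin n → ℕ) → ℕ → Fin n → ℕ
raise a s j = a j + χ[ s ≤ toℕ j ]

vertex : ∀ {n} → (Fin n → ℕ) → Permutation′ n → ℕ → Point n
vertex a α s = tabulate (raise a s ∘ (α ⟨$⟩ʳ_))

lookup-ext : ∀ {n} {u w : Point n} → (∀ p → lookup u p ≡ lookup w p) → u ≡ w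
lookup-ext {u = u} {w} u≗w =
  trans (sym (tabulate∘lookup u)) (trans (tabulate-cong u≗w) (tabulate∘lookup w))

lookup-vertex : ∀ {n} (a : Fin n → ℕ) α s p → lookup (vertex a α s) p ≡ raise a s (α ⟨$⟩ʳ p)
lookup-vertex a α s = lookup∘tabulate (raise a s ∘ (α ⟨$⟩ʳ_))

vertex-step : ∀ {n} (a : Fin n → ℕ) α (r : Fin n) →
              vertex a α (suc (toℕ r)) +e (α ⟨$⟩ˡ r) ≡ vertex a α (toℕ r)
vertex-step a α r = lookup-ext lookup-step
  where
  t = toℕ r
  r′ = α ⟨$⟩ˡ r
  lookup-step : ∀ p → lookup (vertex a α (suc t) +e r′) p ≡ lookup (vertex a α t) p
  lookup-step p with p Finₚ.≟ r′
  ... | yes refl = begin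
    lookup (vertex a α (suc t) +e r′) r′  ≡⟨ lookup∘updateAt r′ (vertex a α (suc t)) ⟩
    suc (lookup (vertex a α (suc t)) r′)  ≡⟨ cong ℕ.suc (lookup-vertex a α (suc t) r′) ⟩
    suc (raise a (suc t) (α ⟨$⟩ʳ r′))     ≡⟨ cong (ℕ.suc ∘ raise a (suc t)) (inverseʳ α) ⟩
    suc (a r + χ[ suc t ≤ t ])            ≡⟨ cong (λ x → suc (a r + x)) (χ-> (n<1+n t)) ⟩
    suc (a r + 0)                         ≡⟨ sym (+-suc (a r) 0) ⟩
    a r + 1                               ≡⟨ cong (a r +_) (sym (χ-≤ (≤-refl {t}))) ⟩
    raise a t r                           ≡⟨ cong (raise a t) (inverseʳ α) ⟨
    raise a t (α ⟨$⟩ʳ r′)                 ≡⟨ lookup-vertex a α t r′ ⟨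
    lookup (vertex a α t) r′              ∎
    where open ≡-Reasoning
  ... | no p≢r′ = begin
    lookup (vertex a α (suc t) +e r′) p   ≡⟨ lookup∘updateAt′ p r′ p≢r′ (vertex a α (suc t)) ⟩
    lookup (vertex a α (suc t)) p         ≡⟨ lookup-vertex a α (suc t) p ⟩
    raise a (suc t) (α ⟨$⟩ʳ p)            ≡⟨ cong (a (α ⟨$⟩ʳ p) +_) (χ-suc αp≢r) ⟩
    raise a t (α ⟨$⟩ʳ p)                  ≡⟨ lookup-vertex a α t p ⟨
    lookup (vertex a α t) p               ∎
    where
    open ≡-Reasoning
    αp≢r : toℕ (α ⟨$⟩ʳ p) ≢ t
    αp≢r αp≡r = p≢r′ (trans (sym (inverseˡ α)) (cong (α ⟨$⟩ˡ_) (Finₚ.toℕ-injective αp≡r)))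

simplexVertexℕ≡vertex : ∀ {n} (a : Fin n → ℕ) α j (j≤n : j ≤ n) →
                        simplexVertexℕ (vOf a α) (flip α) j j≤n ≡ vertex a α (n ∸ j)
simplexVertexℕ≡vertex a α zero _ = tabulate-cong λ p →
  sym (trans (cong (a (α ⟨$⟩ʳ p) +_) (χ-> (Finₚ.toℕ<n (α ⟨$⟩ʳ p)))) (+-identityʳ _))
simplexVertexℕ≡vertex {n} a α (suc j) j<n = begin
  simplexVertexℕ (vOf a α) (flip α) j (<⇒≤ j<n) +e r′
    ≡⟨ cong (_+e r′) (simplexVertexℕ≡vertex a α j (<⇒≤ j<n)) ⟩
  vertex a α (n ∸ j) +e r′        ≡⟨ cong (λ s → vertex a α s +e r′) n∸j≡1+r ⟩
  vertex a α (suc (toℕ r)) +e r′  ≡⟨ vertex-step a α r ⟩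
  vertex a α (toℕ r)              ≡⟨ cong (vertex a α) toℕ-r ⟩
  vertex a α (n ∸ suc j)          ∎
  where
  open ≡-Reasoning
  r = opposite (fromℕ< j<n)
  r′ = α ⟨$⟩ˡ r
  toℕ-r : toℕ r ≡ n ∸ suc j
  toℕ-r = trans (Finₚ.opposite-prop (fromℕ< j<n)) (cong (λ x → n ∸ suc x) (Finₚ.toℕ-fromℕ< j<n))
  n∸j≡1+r : n ∸ j ≡ suc (toℕ r)
  n∸j≡1+r = trans (+-∸-assoc 1 j<n) (cong suc (sym toℕ-r))

∈F⇒vertex : ∀ {n} {x : Point n} {a : Fin n → ℕ} → x ∈F a →
            ∃[ α ] IsSortPerm a α × ∃[ t ] t ≤ n × x ≡ vertex a α t
∈F⇒vertex {n} {a = a} (α , α-sorts , j , x≡) =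
  α , α-sorts , n ∸ toℕ j , m∸n≤m n (toℕ j) , trans x≡ (simplexVertexℕ≡vertex a α (toℕ j) _)

vertex∈F : ∀ {n} (a : Fin n → ℕ) α {t} → IsSortPerm a α → t ≤ n → vertex a α t ∈F a
vertex∈F {n} a α {t} α-sorts t≤n = α , α-sorts , j , sym (begin
  simplexVertex (vOf a α) (flip α) j  ≡⟨ simplexVertexℕ≡vertex a α (toℕ j) _ ⟩
  vertex a α (n ∸ toℕ j)              ≡⟨ cong (vertex a α ∘ (n ∸_)) (Finₚ.toℕ-fromℕ< n∸t<1+n) ⟩
  vertex a α (n ∸ (n ∸ t))            ≡⟨ cong (vertex a α) (m∸[m∸n]≡n t≤n) ⟩
  vertex a α t                        ∎)
  where
  open ≡-Reasoning
  n∸t<1+n = s≤s (m∸n≤m n t)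
  j = fromℕ< n∸t<1+n

stat : ∀ {n} → (ℕ → ℕ) → (Fin n → ℕ) → ℕ → ℕ
stat φ a s = sum (φ ∘ raise a s)

stat-vertex : ∀ {n} φ (a : Fin n → ℕ) α s → sum (φ ∘ lookup (vertex a α s)) ≡ stat φ a s
stat-vertex φ a α s = trans (sum-cong-≗ (cong φ ∘ lookup-vertex a α s)) (sum-∘-permute (φ ∘ raise a s) α)

stat-id : ∀ {n} (y : Fin n → ℕ) t → stat id y t ≡ sum y + (n ∸ t)
stat-id {n} y t = trans (∑-distrib-+ y _) (cong (sum y +_) (sum-χ≡∸ n t))

stat-id-index : ∀ {n} {a b : Fin n → ℕ} {s t} → sum b ≡ sum a → s ≤ n → t ≤ n →
                stat id b s ≡ stat id a t → s ≡ t
stat-id-index {n} {a} {b} {s} {t} Σb≡Σa s≤n t≤n same =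
  ∸-cancelˡ-≡ s≤n t≤n (+-cancelˡ-≡ (sum b) _ _ (begin
    sum b + (n ∸ s)  ≡⟨ stat-id b s ⟨
    stat id b s      ≡⟨ same ⟩
    stat id a t      ≡⟨ stat-id a t ⟩
    sum a + (n ∸ t)  ≡⟨ cong (_+ (n ∸ t)) Σb≡Σa ⟨
    sum b + (n ∸ t)  ∎))
  where open ≡-Reasoning

stat-split : ∀ {n} {φ : ℕ → ℕ} → (∀ {u v} → u ≤ v → φ u ≤ φ v) →
             ∀ (y : Fin n → ℕ) {s s′} → s ≤ s′ →
             stat φ y s ≡ stat φ y s′ + sum (λ j → φ (raise y s j) ∸ φ (raise y s′ j))
stat-split {φ = φ} φ-mono y {s} {s′} s≤s′ =
  trans (sum-cong-≗ λ j → sym (m+[n∸m]≡n (φ-mono (+-monoʳ-≤ (y j) (χ-antitone (toℕ j) s≤s′)))))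
        (∑-distrib-+ (φ ∘ raise y s′) (λ j → φ (raise y s j) ∸ φ (raise y s′ j)))

-- F(a) does not contain vertex s of F(b), as certified by permutation-invariant statistics.
Avoids : ∀ {n} → (Fin n → ℕ) → (Fin n → ℕ) → ℕ → Set
Avoids {n} a b s = ∀ t → t ≤ n → ¬ (∀ φ → stat φ b s ≡ stat φ a t)

Avoids⇒∉F : ∀ {n} {a b : Fin n → ℕ} {s} → Avoids a b s → ∀ α → ¬ vertex b α s ∈F a
Avoids⇒∉F {a = a} {b} {s} avoids α vertex∈a with ∈F⇒vertex {a = a} vertex∈a
... | β , _ , t , t≤n , b-vertex≡a-vertex = avoids t t≤n λ φ → begin
  stat φ b s                       ≡⟨ stat-vertex φ b α s ⟨
  sum (φ ∘ lookup (vertex b α s))  ≡⟨ cong (λ x → sum (φ ∘ lookup x)) b-vertex≡a-vertex ⟩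
  sum (φ ∘ lookup (vertex a β t))  ≡⟨ stat-vertex φ a β t ⟩
  stat φ a t                       ∎
  where open ≡-Reasoning

-- With equal sums, stat id pins down the index of a vertex.
avoids-by-≢ : ∀ {n} (a b : Fin n → ℕ) {s} → sum b ≡ sum a → s ≤ n →
              ∀ φ → stat φ b s ≢ stat φ a s → Avoids a b s
avoids-by-≢ a b Σb≡Σa s≤n φ differs t t≤n same =
  differs (trans (same φ) (cong (stat φ a) (sym (stat-id-index {a = a} {b} Σb≡Σa s≤n t≤n (same id)))))

avoids-by-< : ∀ {n} (a b : Fin n → ℕ) {s} φ →
              (∀ t → t ≤ n → stat φ a t < stat φ b s) → Avoids a b s
avoids-by-< a b φ below t t≤n same = <-irrefl (sym (same φ)) (below t t≤n)

KeyLess : ∀ {n} → (Fin n → ℕ) → Rel (Fin n) 0ℓ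
KeyLess b x y = ×-Lex _≡_ _<_ _<_ (b x , toℕ x) (b y , toℕ y)

KeyLess-trans : ∀ {n} (b : Fin n → ℕ) → Transitive (KeyLess b)
KeyLess-trans b {x} {y} {z} =
  ×-transitive {_≈₁_ = _≡_} {_<₁_ = _<_} {_<₂_ = _<_} isEquivalence (resp₂ _<_) <-trans <-trans
               {b x , toℕ x} {b y , toℕ y} {b z , toℕ z}

KeyLess-irrefl : ∀ {n} (b : Fin n → ℕ) {x} → ¬ KeyLess b x x
KeyLess-irrefl b (inj₁ bx<bx)     = <-irrefl refl bx<bx
KeyLess-irrefl b (inj₂ (_ , x<x)) = <-irrefl refl x<x

KeyLess⇒≤ : ∀ {n} {b : Fin n → ℕ} {x y} → KeyLess b x y → b x ≤ b y
KeyLess⇒≤ (inj₁ bx<by)       = <⇒≤ bx<by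
KeyLess⇒≤ (inj₂ (bx≡by , _)) = ≤-reflexive bx≡by

sorted-adjacent : ∀ {n} {b : Fin n → ℕ} {α} → IsSortPerm b α →
                  ∀ p q → toℕ q ≡ suc (toℕ p) → KeyLess b (α ⟨$⟩ʳ p) (α ⟨$⟩ʳ q)
sorted-adjacent {b = b} {α} α-sorts p q q≡1+p
  with α-sorts p q q≡1+p | b (α ⟨$⟩ʳ p) ℕ.<? b (α ⟨$⟩ʳ q)
... | _           | yes bp<bq = inj₁ bp<bq
... | bp≤bq , tie | no  bp≮bq = inj₂ (bp≡bq , tie bp≡bq)
  where bp≡bq = ≤-antisym bp≤bq (≮⇒≥ bp≮bq)

adjacent⇒sorted : ∀ {n} {b : Fin n → ℕ} {α} →
                  (∀ p q → toℕ q ≡ suc (toℕ p) → KeyLess b (α ⟨$⟩ʳ p) (α ⟨$⟩ʳ q)) →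
                  IsSortPerm b α
adjacent⇒sorted adjacent p q q≡1+p with adjacent p q q≡1+p
... | inj₁ bp<bq         = <⇒≤ bp<bq , λ bp≡bq → ⊥-elim (<-irrefl bp≡bq bp<bq)
... | inj₂ (bp≡bq , p<q) = ≤-reflexive bp≡bq , λ _ → p<q

sorted-increasing : ∀ {n} {b : Fin n → ℕ} {α} → IsSortPerm b α →
                    ∀ {p q} → toℕ p < toℕ q → KeyLess b (α ⟨$⟩ʳ p) (α ⟨$⟩ʳ q)
sorted-increasing {suc m} {b} {α} α-sorts =
  chain (λ x y → KeyLess b (α ⟨$⟩ʳ x) (α ⟨$⟩ʳ y)) (KeyLess-trans b) λ i _ _ →
    sorted-adjacent {b = b} {α} α-sorts (inject₁ i) (suc i) (cong suc (sym (Finₚ.toℕ-inject₁ i)))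

sorted-reflects : ∀ {n} {b : Fin n → ℕ} {α} → IsSortPerm b α →
                  ∀ p q → KeyLess b (α ⟨$⟩ʳ p) (α ⟨$⟩ʳ q) → toℕ p < toℕ q
sorted-reflects {b = b} {α} α-sorts p q αp<αq with <-cmp (toℕ p) (toℕ q)
... | tri< p<q _ _ = p<q
... | tri≈ _ p≡q _ rewrite Finₚ.toℕ-injective p≡q = ⊥-elim (KeyLess-irrefl b αp<αq)
... | tri> _ _ q<p =
  ⊥-elim (KeyLess-irrefl b (KeyLess-trans b αp<αq (sorted-increasing {b = b} {α} α-sorts q<p)))

increasing⇒inflationary : ∀ {m} (f : Fin (suc m) → Fin (suc m)) →
                          (∀ {p q} → toℕ p < toℕ q → toℕ (f p) < toℕ (f q)) →
                          ∀ p → toℕ p ≤ toℕ (f p)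
increasing⇒inflationary f f-increasing = <-weakInduction (λ p → toℕ p ≤ toℕ (f p)) z≤n step
  where
  step : ∀ i → toℕ (inject₁ i) ≤ toℕ (f (inject₁ i)) → toℕ (suc i) ≤ toℕ (f (suc i))
  step i i≤fi = <-≤-trans (s≤s (subst (_≤ toℕ (f (inject₁ i))) (Finₚ.toℕ-inject₁ i) i≤fi))
                          (f-increasing (≤-reflexive (cong suc (Finₚ.toℕ-inject₁ i))))

sorted⁻¹∘sorted-increasing : ∀ {n} {b : Fin n → ℕ} {α β} → IsSortPerm b α → IsSortPerm b β →
                             ∀ {x y} → toℕ x < toℕ y →
                             toℕ (α ⟨$⟩ˡ (β ⟨$⟩ʳ x)) < toℕ (α ⟨$⟩ˡ (β ⟨$⟩ʳ y))
sorted⁻¹∘sorted-increasing {b = b} {α} {β} α-sorts β-sorts x<y =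
  sorted-reflects {b = b} {α} α-sorts _ _
    (subst₂ (KeyLess b) (sym (inverseʳ α)) (sym (inverseʳ α)) (sorted-increasing {b = b} {β} β-sorts x<y))

sortPerm-unique : ∀ {n} {b : Fin n → ℕ} {α β} → IsSortPerm b α → IsSortPerm b β →
                  ∀ p → α ⟨$⟩ʳ p ≡ β ⟨$⟩ʳ p
sortPerm-unique {suc m} {b} {α} {β} α-sorts β-sorts p = begin
  α ⟨$⟩ʳ p    ≡⟨ cong (α ⟨$⟩ʳ_) (Finₚ.toℕ-injective (≤-antisym γp≤p p≤γp)) ⟨
  α ⟨$⟩ʳ γ p  ≡⟨ inverseʳ α ⟩
  β ⟨$⟩ʳ p    ∎
  where
  open ≡-Reasoning
  γ δ : Fin (suc m) → Fin (suc m)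
  γ x = α ⟨$⟩ˡ (β ⟨$⟩ʳ x)
  δ x = β ⟨$⟩ˡ (α ⟨$⟩ʳ x)
  p≤γp : toℕ p ≤ toℕ (γ p)
  p≤γp = increasing⇒inflationary γ (sorted⁻¹∘sorted-increasing {b = b} {α} {β} α-sorts β-sorts) p
  γp≤p : toℕ (γ p) ≤ toℕ p
  γp≤p = subst (λ x → toℕ (γ p) ≤ toℕ x) (trans (cong (β ⟨$⟩ˡ_) (inverseʳ α)) (inverseˡ β))
    (increasing⇒inflationary δ (sorted⁻¹∘sorted-increasing {b = b} {β} {α} β-sorts α-sorts) (γ p))

vertex-unique : ∀ {n} {b : Fin n → ℕ} {α β} → IsSortPerm b α → IsSortPerm b β →
                ∀ s → vertex b α s ≡ vertex b β s
vertex-unique {b = b} {α} {β} α-sorts β-sorts s =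
  tabulate-cong (cong (raise b s) ∘ sortPerm-unique {b = b} {α} {β} α-sorts β-sorts)

firstMinimum : ∀ {m} (b : Fin (suc m) → ℕ) →
               ∃[ i ] (∀ k → b i ≤ b k) × (∀ k → b i ≡ b k → toℕ i ≤ toℕ k)
firstMinimum {zero}  b = zero , (λ { zero → ≤-refl }) , (λ _ _ → z≤n)
firstMinimum {suc m} b with firstMinimum (b ∘ suc)
... | i , minimal , first with b zero ℕ.≤? b (suc i)
...   | yes b₀≤bi = zero , (λ { zero → ≤-refl ; (suc k) → ≤-trans b₀≤bi (minimal k) })
                         , (λ _ _ → z≤n)
...   | no  b₀≰bi = suc i , (λ { zero → <⇒≤ (≰⇒> b₀≰bi) ; (suc k) → minimal k })
                          , (λ { zero bi≡b₀ → ⊥-elim (<-irrefl bi≡b₀ (≰⇒> b₀≰bi))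
                               ; (suc k) bi≡bk → s≤s (first k bi≡bk) })

punchIn-mono-< : ∀ {n} i (j k : Fin n) → toℕ j < toℕ k → toℕ (punchIn i j) < toℕ (punchIn i k)
punchIn-mono-< i j k j<k = ≰⇒> (λ ik≤ij → <⇒≱ j<k (Finₚ.punchIn-cancel-≤ i k j ik≤ij))

sortPerm : ∀ {n} (b : Fin n → ℕ) → ∃ (IsSortPerm b)
sortPerm {zero}  b = Perm.id , λ ()
sortPerm {suc m} b with firstMinimum b
... | i₀ , minimal , first with sortPerm (b ∘ punchIn i₀)
...   | α , α-sorts = Perm.insert zero i₀ α , sorts
  where
  sorts : IsSortPerm b (Perm.insert zero i₀ α)
  sorts zero    (suc zero) _ = minimal _ , λ b₀≡ →
    ≤∧≢⇒< (first _ b₀≡) (λ i₀≡ → Finₚ.punchInᵢ≢i i₀ _ (Finₚ.toℕ-injective (sym i₀≡)))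
  sorts (suc p) (suc q) q≡1+p with α-sorts p q (suc-injective q≡1+p)
  ... | bp≤bq , tie = bp≤bq , λ bp≡bq → punchIn-mono-< i₀ _ _ (tie bp≡bq)

RevLex : ∀ {n} → Rel (Fin n → ℕ) 0ℓ
RevLex a b = ∃[ i ] ((∀ j → toℕ j < toℕ i → a j ≡ b j) × b i < a i)

RevLex-irrefl : ∀ {n} {a b : Fin n → ℕ} → a ≗ b → ¬ RevLex a b
RevLex-irrefl a≗b (i , _ , bi<ai) = <-irrefl (sym (a≗b i)) bi<ai

RevLex-trans : ∀ {n} {a b c : Fin n → ℕ} → RevLex a b → RevLex b c → RevLex a c
RevLex-trans {a = a} {b} {c} (i , a≡b , bi<ai) (i′ , b≡c , ci′<bi′) with <-cmp (toℕ i) (toℕ i′)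
... | tri< i<i′ _ _ =
  i , (λ j j<i → trans (a≡b j j<i) (b≡c j (<-trans j<i i<i′)))
    , subst (_< a i) (b≡c i i<i′) bi<ai
... | tri≈ _ i≡i′ _ rewrite Finₚ.toℕ-injective i≡i′ =
  i′ , (λ j j<i′ → trans (a≡b j j<i′) (b≡c j j<i′)) , <-trans ci′<bi′ bi<ai
... | tri> _ _ i′<i =
  i′ , (λ j j<i′ → trans (a≡b j (<-trans j<i′ i′<i)) (b≡c j j<i′))
     , subst (c i′ <_) (sym (a≡b i′ i′<i)) ci′<bi′

RevLex-resp : ∀ {n} {a a′ b b′ : Fin n → ℕ} → a ≗ a′ → b ≗ b′ → RevLex a b → RevLex a′ b′
RevLex-resp a≗a′ b≗b′ (i , a≡b , bi<ai) =
  i , (λ j j<i → trans (sym (a≗a′ j)) (trans (a≡b j j<i) (b≗b′ j)))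
    , subst₂ _<_ (b≗b′ i) (a≗a′ i) bi<ai

revLex-compare : ∀ {n} (a b : Fin n → ℕ) → a ≗ b ⊎ RevLex a b ⊎ RevLex b a
revLex-compare {zero}  a b = inj₁ λ ()
revLex-compare {suc n} a b with <-cmp (a zero) (b zero)
... | tri< a₀<b₀ _ _ = inj₂ (inj₂ (zero , (λ _ ()) , a₀<b₀))
... | tri> _ _ b₀<a₀ = inj₂ (inj₁ (zero , (λ _ ()) , b₀<a₀))
... | tri≈ _ a₀≡b₀ _ with revLex-compare (a ∘ suc) (b ∘ suc)
...   | inj₁ a≗b = inj₁ λ { zero → a₀≡b₀ ; (suc j) → a≗b j }
...   | inj₂ (inj₁ (i , a≡b , lt)) =
        inj₂ (inj₁ (suc i , (λ { zero _ → a₀≡b₀ ; (suc j) (s≤s j<i) → a≡b j j<i }) , lt))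
...   | inj₂ (inj₂ (i , b≡a , lt)) =
        inj₂ (inj₂ (suc i , (λ { zero _ → sym a₀≡b₀ ; (suc j) (s≤s j<i) → b≡a j j<i }) , lt))

mx-cong : ∀ {n} {a b : Fin n → ℕ} → a ≗ b → mx a ≡ mx b
mx-cong a≗b = cong (Data.Vec.foldr _ _⊔_ 0) (tabulate-cong a≗b)

Sm-cong : ∀ {n} {a b : Fin n → ℕ} → a ≗ b → Sm a ≡ Sm b
Sm-cong a≗b = cong Data.Vec.sum (tabulate-cong a≗b)

≺-irrefl : ∀ {n} {a b : Fin n → ℕ} → a ≗ b → ¬ a ≺ b
≺-irrefl a≗b (inj₁ m<)                 = <-irrefl (mx-cong a≗b) m<
≺-irrefl a≗b (inj₂ (inj₁ (_ , s<)))    = <-irrefl (Sm-cong a≗b) s<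
≺-irrefl a≗b (inj₂ (inj₂ (_ , _ , l))) = RevLex-irrefl a≗b l

≺-trans : ∀ {n} {a b c : Fin n → ℕ} → a ≺ b → b ≺ c → a ≺ c
≺-trans (inj₁ m<) (inj₁ m<′)                  = inj₁ (<-trans m< m<′)
≺-trans (inj₁ m<) (inj₂ (inj₁ (m≡′ , _)))     = inj₁ (<-≤-trans m< (≤-reflexive m≡′))
≺-trans (inj₁ m<) (inj₂ (inj₂ (m≡′ , _)))     = inj₁ (<-≤-trans m< (≤-reflexive m≡′))
≺-trans (inj₂ (inj₁ (m≡ , _))) (inj₁ m<′)     = inj₁ (≤-<-trans (≤-reflexive m≡) m<′)
≺-trans (inj₂ (inj₂ (m≡ , _))) (inj₁ m<′)     = inj₁ (≤-<-trans (≤-reflexive m≡) m<′)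
≺-trans (inj₂ (inj₁ (m≡ , s<))) (inj₂ (inj₁ (m≡′ , s<′))) =
  inj₂ (inj₁ (trans m≡ m≡′ , <-trans s< s<′))
≺-trans (inj₂ (inj₁ (m≡ , s<))) (inj₂ (inj₂ (m≡′ , s≡′ , _))) =
  inj₂ (inj₁ (trans m≡ m≡′ , <-≤-trans s< (≤-reflexive s≡′)))
≺-trans (inj₂ (inj₂ (m≡ , s≡ , _))) (inj₂ (inj₁ (m≡′ , s<′))) =
  inj₂ (inj₁ (trans m≡ m≡′ , ≤-<-trans (≤-reflexive s≡) s<′))
≺-trans (inj₂ (inj₂ (m≡ , s≡ , l))) (inj₂ (inj₂ (m≡′ , s≡′ , l′))) =
  inj₂ (inj₂ (trans m≡ m≡′ , trans s≡ s≡′ , RevLex-trans l l′))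

≺-resp : ∀ {n} {a a′ b b′ : Fin n → ℕ} → a ≗ a′ → b ≗ b′ → a ≺ b → a′ ≺ b′
≺-resp a≗a′ b≗b′ (inj₁ m<) = inj₁ (subst₂ _<_ (mx-cong a≗a′) (mx-cong b≗b′) m<)
≺-resp a≗a′ b≗b′ (inj₂ (inj₁ (m≡ , s<))) =
  inj₂ (inj₁ ( trans (sym (mx-cong a≗a′)) (trans m≡ (mx-cong b≗b′))
             , subst₂ _<_ (Sm-cong a≗a′) (Sm-cong b≗b′) s<))
≺-resp a≗a′ b≗b′ (inj₂ (inj₂ (m≡ , s≡ , l))) =
  inj₂ (inj₂ ( trans (sym (mx-cong a≗a′)) (trans m≡ (mx-cong b≗b′))
             , trans (sym (Sm-cong a≗a′)) (trans s≡ (Sm-cong b≗b′))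
             , RevLex-resp a≗a′ b≗b′ l))

≺-connex : ∀ {n} (a b : Fin n → ℕ) → a ≺ b ⊎ a ≗ b ⊎ b ≺ a
≺-connex a b with <-cmp (mx a) (mx b)
... | tri< m< _ _ = inj₁ (inj₁ m<)
... | tri> _ _ m> = inj₂ (inj₂ (inj₁ m>))
... | tri≈ _ m≡ _ with <-cmp (Sm a) (Sm b)
...   | tri< s< _ _ = inj₁ (inj₂ (inj₁ (m≡ , s<)))
...   | tri> _ _ s> = inj₂ (inj₂ (inj₂ (inj₁ (sym m≡ , s>))))
...   | tri≈ _ s≡ _ with revLex-compare a b
...     | inj₁ a≗b      = inj₂ (inj₁ a≗b)
...     | inj₂ (inj₁ l) = inj₁ (inj₂ (inj₂ (m≡ , s≡ , l)))
...     | inj₂ (inj₂ l) = inj₂ (inj₂ (inj₂ (inj₂ (sym m≡ , sym s≡ , l))))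

≺-asym : ∀ {n} {a b : Fin n → ℕ} → a ≺ b → ¬ b ≺ a
≺-asym a≺b b≺a = ≺-irrefl (λ _ → refl) (≺-trans a≺b b≺a)

≺-compare : ∀ {n} → Trichotomous _≗_ (_≺_ {n})
≺-compare a b with ≺-connex a b
... | inj₁ a≺b        = tri< a≺b (λ a≗b → ≺-irrefl a≗b a≺b) (≺-asym a≺b)
... | inj₂ (inj₁ a≗b) = tri≈ (≺-irrefl a≗b) a≗b (≺-irrefl (sym ∘ a≗b))
... | inj₂ (inj₂ b≺a) = tri> (≺-asym b≺a) (λ a≗b → ≺-irrefl (sym ∘ a≗b) b≺a) b≺a

≺-isStrictTotalOrder : ∀ {n} → IsStrictTotalOrder {A = Fin n → ℕ} _≗_ _≺_
≺-isStrictTotalOrder = record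
  { isStrictPartialOrder = record
    { isEquivalence = record
      { refl  = λ _ → refl
      ; sym   = sym ∘_
      ; trans = λ f≗g g≗h x → trans (f≗g x) (g≗h x)
      }
    ; irrefl        = ≺-irrefl
    ; trans         = ≺-trans
    ; <-resp-≈      = ≺-resp (λ _ → refl) , λ a≗a′ → ≺-resp a≗a′ (λ _ → refl)
    }
  ; compare = ≺-compare
  }

-- Facets adjacent to F(b)

relabel : ∀ {n} → Permutation′ n → (Fin n → ℕ) → Fin n → ℕ
relabel π h = h ∘ (π ⟨$⟩ˡ_)

relabel-∘ : ∀ {n} (π : Permutation′ n) h z → relabel π h (π ⟨$⟩ʳ z) ≡ h z
relabel-∘ π h z = cong h (inverseˡ π)

sum-relabel : ∀ {n} (π : Permutation′ n) h → sum (relabel π h) ≡ sum h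
sum-relabel π h = sum-∘-permute h (flip π)

sorted-relabel : ∀ {n} (b h : Fin n → ℕ) (π : Permutation′ n) →
                 (∀ {x y} → KeyLess b x y → KeyLess (relabel π h) (π ⟨$⟩ʳ x) (π ⟨$⟩ʳ y)) →
                 ∀ {α} → IsSortPerm b α → IsSortPerm (relabel π h) (α Perm.∘ₚ π)
sorted-relabel b h π preserves {α} α-sorts = adjacent⇒sorted {b = relabel π h} {α Perm.∘ₚ π}
  λ p q q≡1+p → preserves (sorted-adjacent {b = b} {α} α-sorts p q q≡1+p)

vertex∈F-relabel : ∀ {n} (b h : Fin n → ℕ) (π : Permutation′ n) →
                   (∀ {x y} → KeyLess b x y → KeyLess (relabel π h) (π ⟨$⟩ʳ x) (π ⟨$⟩ʳ y)) →
                   ∀ {s t} → (∀ z → raise b s z ≡ raise (relabel π h) t (π ⟨$⟩ʳ z)) → t ≤ n →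
                   ∀ α → IsSortPerm b α → vertex b α s ∈F relabel π h
vertex∈F-relabel b h π preserves same t≤n α α-sorts =
  subst (_∈F relabel π h) (sym (tabulate-cong (same ∘ (α ⟨$⟩ʳ_))))
        (vertex∈F (relabel π h) (α Perm.∘ₚ π) (sorted-relabel b h π preserves {α} α-sorts) t≤n)

-- F(c) lies across the ridge of F(b) opposite to vertex s.
record Adjacent {n} (q : ℕ) (b : Fin n → ℕ) (s : ℕ) : Set where
  field
    c      : Fin n → ℕ
    c-inS  : InS q c
    c≺b    : c ≺ b
    shares : ∀ α → IsSortPerm b α → ∀ t → t ≤ n → t ≢ s → vertex b α t ∈F c
    avoids : Avoids c b s

punchIn-fromℕ : ∀ {m} (k : Fin m) → punchIn (Fin.fromℕ m) k ≡ inject₁ k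
punchIn-fromℕ zero    = refl
punchIn-fromℕ (suc k) = cong suc (punchIn-fromℕ k)

-- c = (b₁, …, b_m, b₀ − 1), across the ridge opposite to vertex 0.
module Rotation {m} (b : Fin (suc m) → ℕ) (b₀>0 : 1 ≤ b zero) where

  -- ρ sends 0 to m and j + 1 to j.
  ρ : Permutation′ (suc m)
  ρ = Perm.insert zero (Fin.fromℕ m) Perm.id

  h : Fin (suc m) → ℕ
  h zero    = ℕ.pred (b zero)
  h (suc j) = b (suc j)

  c : Fin (suc m) → ℕ
  c = relabel ρ h

  1+h₀ : suc (h zero) ≡ b zero
  1+h₀ = suc-pred (b zero) ⦃ >-nonZero b₀>0 ⦄

  h≤b : ∀ z → h z ≤ b z
  h≤b zero    = pred[n]≤n
  h≤b (suc z) = ≤-refl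

  1+sum-c : suc (sum c) ≡ sum b
  1+sum-c = trans (cong suc (sum-relabel ρ h)) (cong (_+ sum (b ∘ suc)) 1+h₀)

  c≺b : c ≺ b
  c≺b with m≤n⇒m<n∨m≡n (mx-least c (λ j → ≤-trans (h≤b (ρ ⟨$⟩ˡ j)) (≤-mx b (ρ ⟨$⟩ˡ j))))
  ... | inj₁ m< = inj₁ m<
  ... | inj₂ m≡ = inj₂ (inj₁ (m≡ , subst₂ _<_ (sym (Sm≡sum c)) (sym (Sm≡sum b)) (≤-reflexive 1+sum-c)))

  toℕ-ρ-suc : ∀ x → toℕ (ρ ⟨$⟩ʳ suc x) ≡ toℕ x
  toℕ-ρ-suc x = trans (cong toℕ (punchIn-fromℕ x)) (Finₚ.toℕ-inject₁ x)

  preserves : ∀ {x y} → KeyLess b x y → KeyLess c (ρ ⟨$⟩ʳ x) (ρ ⟨$⟩ʳ y)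
  preserves {x} {y} x<y rewrite relabel-∘ ρ h x | relabel-∘ ρ h y = go x y x<y
    where
    go : ∀ x y → KeyLess b x y → h x < h y ⊎ (h x ≡ h y × toℕ (ρ ⟨$⟩ʳ x) < toℕ (ρ ⟨$⟩ʳ y))
    go zero    zero    x<x = ⊥-elim (KeyLess-irrefl b x<x)
    go zero    (suc y) x<y = inj₁ (<-≤-trans (≤-reflexive 1+h₀) (KeyLess⇒≤ {b = b} x<y))
    go (suc x) zero    (inj₁ bx<b₀) with m≤n⇒m<n∨m≡n (<⇒≤pred bx<b₀)
    ... | inj₁ hx<h₀ = inj₁ hx<h₀
    ... | inj₂ hx≡h₀ =
      inj₂ (hx≡h₀ , subst₂ _<_ (sym (toℕ-ρ-suc x)) (sym (Finₚ.toℕ-fromℕ m)) (Finₚ.toℕ<n x))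
    go (suc x) (suc y) (inj₁ bx<by)         = inj₁ bx<by
    go (suc x) (suc y) (inj₂ (bx≡by , x<y)) = inj₂ (bx≡by , punchIn-mono-< (Fin.fromℕ m) x y (≤-pred x<y))

  raise-ρ : ∀ {t} → t ≤ m → ∀ z → raise b (suc t) z ≡ raise c t (ρ ⟨$⟩ʳ z)
  raise-ρ {t} t≤m z rewrite relabel-∘ ρ h z = go z
    where
    go : ∀ z → raise b (suc t) z ≡ h z + χ[ t ≤ toℕ (ρ ⟨$⟩ʳ z) ]
    go zero = begin
      b zero + 0                        ≡⟨ +-identityʳ (b zero) ⟩
      b zero                            ≡⟨ 1+h₀ ⟨
      suc (h zero)                      ≡⟨ +-comm 1 (h zero) ⟩
      h zero + 1                        ≡⟨ cong (h zero +_) (χ-≤ t≤last) ⟨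
      h zero + χ[ t ≤ toℕ (Fin.fromℕ m) ] ∎
      where
      open ≡-Reasoning
      t≤last = subst (t ≤_) (sym (Finₚ.toℕ-fromℕ m)) t≤m
    go (suc z) = cong (λ k → b (suc z) + χ[ t ≤ k ]) (sym (toℕ-ρ-suc z))

  avoids : Avoids c b 0
  avoids = avoids-by-< c b {0} id λ t _ → begin-strict
    stat id c t          ≡⟨ stat-id c t ⟩
    sum c + (suc m ∸ t)  ≤⟨ +-monoʳ-≤ (sum c) (m∸n≤m (suc m) t) ⟩
    sum c + suc m        <⟨ +-monoˡ-< (suc m) (≤-reflexive 1+sum-c) ⟩
    sum b + suc m        ≡⟨ stat-id b 0 ⟨
    stat id b 0          ∎
    where open ≤-Reasoning

  adjacent : ∀ {q} → InS q b → Adjacent q b 0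
  adjacent b-inS = record
    { c      = c
    ; c-inS  = λ j → ≤-<-trans (h≤b (ρ ⟨$⟩ˡ j)) (b-inS (ρ ⟨$⟩ˡ j))
    ; c≺b    = c≺b
    ; shares = λ { _ _ zero _ 0≢0 → ⊥-elim (0≢0 refl)
                 ; α α-sorts (suc t) t<n _ →
                     vertex∈F-relabel b h ρ preserves {suc t} {t} (raise-ρ (≤-pred t<n)) (<⇒≤ t<n)
                                      α α-sorts }
    ; avoids = avoids
    }

transpose-matchˡ : ∀ {n} (i j : Fin n) → PC.transpose i j i ≡ j
transpose-matchˡ i j rewrite dec-true (i Finₚ.≟ i) refl = refl

transpose-matchʳ : ∀ {n} (i j : Fin n) → PC.transpose i j j ≡ i
transpose-matchʳ i j with j Finₚ.≟ i
... | yes j≡i = j≡i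
... | no  _   rewrite dec-true (j Finₚ.≟ j) refl = refl

transpose-other : ∀ {n} {i j k : Fin n} → k ≢ i → k ≢ j → PC.transpose i j k ≡ k
transpose-other {i = i} {j} {k} k≢i k≢j
  rewrite dec-false (k Finₚ.≟ i) k≢i | dec-false (k Finₚ.≟ j) k≢j = refl

-- c = b with the entries b_i < b_{i+1} exchanged, across the ridge opposite to vertex i + 1.
module Transposition {m} (b : Fin (suc m) → ℕ) (i : Fin m) (ascent : b (inject₁ i) < b (suc i)) where

  I J : Fin (suc m)
  I = inject₁ i
  J = suc i

  toℕ-I : toℕ I ≡ toℕ i
  toℕ-I = Finₚ.toℕ-inject₁ i

  I<J : toℕ I < toℕ J
  I<J = ≤-reflexive (cong suc toℕ-I)

  τ : Permutation′ (suc m)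
  τ = Perm.transpose I J

  c : Fin (suc m) → ℕ
  c = relabel τ b

  τ-I : τ ⟨$⟩ʳ I ≡ J
  τ-I = transpose-matchˡ I J

  τ-J : τ ⟨$⟩ʳ J ≡ I
  τ-J = transpose-matchʳ I J

  position : ∀ z → z ≡ I ⊎ z ≡ J ⊎ (z ≢ I × z ≢ J)
  position z with z Finₚ.≟ I | z Finₚ.≟ J
  ... | yes z≡I | _       = inj₁ z≡I
  ... | no  _   | yes z≡J = inj₂ (inj₁ z≡J)
  ... | no  z≢I | no  z≢J = inj₂ (inj₂ (z≢I , z≢J))

  c≺b : c ≺ b
  c≺b = inj₂ (inj₂ (mx-c , trans (Sm≡sum c) (trans (sum-relabel τ b) (sym (Sm≡sum b))) , revLex))
    where
    mx-c : mx c ≡ mx b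
    mx-c = ≤-antisym (mx-least c (λ j → ≤-mx b (τ ⟨$⟩ˡ j)))
                     (mx-least b (λ j → subst (_≤ mx c) (relabel-∘ τ b j) (≤-mx c (τ ⟨$⟩ʳ j))))
    revLex : RevLex c b
    revLex = I , (λ j j<I → cong b (transpose-other (λ { refl → <-asym j<I I<J })
                                                    (λ { refl → <-irrefl refl j<I })))
               , subst (b I <_) (cong b (sym (transpose-matchʳ J I))) ascent

  τ-increasing : ∀ {x y} → toℕ x < toℕ y → ¬ (x ≡ I × y ≡ J) →
                 toℕ (τ ⟨$⟩ʳ x) < toℕ (τ ⟨$⟩ʳ y)
  τ-increasing {x} {y} x<y not-IJ with position x | position y
  ... | inj₁ refl | inj₁ refl        = ⊥-elim (<-irrefl refl x<y)
  ... | inj₁ refl | inj₂ (inj₁ refl) = ⊥-elim (not-IJ (refl , refl))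
  ... | inj₁ refl | inj₂ (inj₂ (y≢I , y≢J)) rewrite τ-I | transpose-other y≢I y≢J =
    ≤∧≢⇒< (subst (_< toℕ y) toℕ-I x<y) (λ J≡y → y≢J (Finₚ.toℕ-injective (sym J≡y)))
  ... | inj₂ (inj₁ refl) | inj₁ refl        = ⊥-elim (<-asym x<y I<J)
  ... | inj₂ (inj₁ refl) | inj₂ (inj₁ refl) = ⊥-elim (<-irrefl refl x<y)
  ... | inj₂ (inj₁ refl) | inj₂ (inj₂ (y≢I , y≢J)) rewrite τ-J | transpose-other y≢I y≢J =
    <-trans I<J x<y
  ... | inj₂ (inj₂ (x≢I , x≢J)) | inj₁ refl rewrite τ-I | transpose-other x≢I x≢J =
    <-trans x<y I<J
  ... | inj₂ (inj₂ (x≢I , x≢J)) | inj₂ (inj₁ refl) rewrite τ-J | transpose-other x≢I x≢J =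
    ≤∧≢⇒< (subst (toℕ x ≤_) (sym toℕ-I) (≤-pred x<y)) (λ x≡I → x≢I (Finₚ.toℕ-injective x≡I))
  ... | inj₂ (inj₂ (x≢I , x≢J)) | inj₂ (inj₂ (y≢I , y≢J))
    rewrite transpose-other x≢I x≢J | transpose-other y≢I y≢J = x<y

  preserves : ∀ {x y} → KeyLess b x y → KeyLess c (τ ⟨$⟩ʳ x) (τ ⟨$⟩ʳ y)
  preserves {x} {y} x<y rewrite relabel-∘ τ b x | relabel-∘ τ b y with x<y
  ... | inj₁ bx<by          = inj₁ bx<by
  ... | inj₂ (bx≡by , x<y′) =
    inj₂ (bx≡by , τ-increasing x<y′ λ { (refl , refl) → <-irrefl bx≡by ascent })

  raise-τ : ∀ {t} → t ≢ toℕ J → ∀ z → raise b t z ≡ raise c t (τ ⟨$⟩ʳ z)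
  raise-τ {t} t≢J z rewrite relabel-∘ τ b z = cong (b z +_) (χ-τ z)
    where
    χ-τ : ∀ z → χ[ t ≤ toℕ z ] ≡ χ[ t ≤ toℕ (τ ⟨$⟩ʳ z) ]
    χ-τ z with position z
    ... | inj₁ refl        rewrite τ-I | toℕ-I = χ-step t≢J
    ... | inj₂ (inj₁ refl) rewrite τ-J | toℕ-I = sym (χ-step t≢J)
    ... | inj₂ (inj₂ (z≢I , z≢J)) rewrite transpose-other z≢I z≢J = refl

  -- φ = _∸ b_{i+1} sees the raised entry b_{i+1} + 1 in vertex i + 1 of F(b), and nothing
  -- in the vertex of F(c) with the same sum.
  φ : ℕ → ℕ
  φ = _∸ b J

  φ-c : Fin (suc m) → ℕ
  φ-c z = φ (raise c (toℕ J) (τ ⟨$⟩ʳ z))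

  raise-c-τ : ∀ t z → raise c t (τ ⟨$⟩ʳ z) ≡ b z + χ[ t ≤ toℕ (τ ⟨$⟩ʳ z) ]
  raise-c-τ t z = cong (_+ χ[ t ≤ toℕ (τ ⟨$⟩ʳ z) ]) (relabel-∘ τ b z)

  φ-c-I : φ-c I ≡ 0
  φ-c-I = begin
    φ (raise c (toℕ J) (τ ⟨$⟩ʳ I))         ≡⟨ cong φ (raise-c-τ (toℕ J) I) ⟩
    φ (b I + χ[ toℕ J ≤ toℕ (τ ⟨$⟩ʳ I) ])  ≡⟨ cong (λ k → φ (b I + χ[ toℕ J ≤ toℕ k ])) τ-I ⟩
    φ (b I + χ[ toℕ J ≤ toℕ J ])           ≡⟨ cong (λ x → φ (b I + x)) (χ-≤ (≤-refl {toℕ J})) ⟩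
    φ (b I + 1)                            ≡⟨ m≤n⇒m∸n≡0 (subst (_≤ b J) (+-comm 1 (b I)) ascent) ⟩
    0                                      ∎
    where open ≡-Reasoning

  φ-c-J : φ-c J ≡ 0
  φ-c-J = begin
    φ (raise c (toℕ J) (τ ⟨$⟩ʳ J))         ≡⟨ cong φ (raise-c-τ (toℕ J) J) ⟩
    φ (b J + χ[ toℕ J ≤ toℕ (τ ⟨$⟩ʳ J) ])  ≡⟨ cong (λ k → φ (b J + χ[ toℕ J ≤ toℕ k ])) τ-J ⟩
    φ (b J + χ[ toℕ J ≤ toℕ I ])           ≡⟨ cong (λ x → φ (b J + x)) (χ-> I<J) ⟩
    φ (b J + 0)                            ≡⟨ cong φ (+-identityʳ (b J)) ⟩
    φ (b J)                                ≡⟨ n∸n≡0 (b J) ⟩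
    0                                      ∎
    where open ≡-Reasoning

  φ-b-J : φ (raise b (toℕ J) J) ≡ 1
  φ-b-J = trans (cong (λ x → φ (b J + x)) (χ-≤ (≤-refl {toℕ J}))) (m+n∸m≡n (b J) 1)

  φ-c≤φ-b : ∀ z → φ-c z ≤ φ (raise b (toℕ J) z)
  φ-c≤φ-b z with position z
  ... | inj₁ refl               = ≤-trans (≤-reflexive φ-c-I) z≤n
  ... | inj₂ (inj₁ refl)        = ≤-trans (≤-reflexive φ-c-J) z≤n
  ... | inj₂ (inj₂ (z≢I , z≢J)) rewrite transpose-other z≢I z≢J | transpose-other z≢J z≢I = ≤-refl

  avoids : Avoids c b (toℕ J)
  avoids = avoids-by-≢ c b (sym (sum-relabel τ b)) (Finₚ.toℕ≤n J) φ λ same →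
    <-irrefl (sym same) (begin-strict
    stat φ c (toℕ J)  ≡⟨ sum-∘-permute (φ ∘ raise c (toℕ J)) τ ⟨
    sum φ-c           <⟨ sum-mono-< φ-c≤φ-b J (subst₂ _<_ (sym φ-c-J) (sym φ-b-J) (s≤s z≤n)) ⟩
    stat φ b (toℕ J)  ∎)
    where open ≤-Reasoning

  adjacent : ∀ {q} → InS q b → Adjacent q b (toℕ J)
  adjacent b-inS = record
    { c      = c
    ; c-inS  = λ j → b-inS (τ ⟨$⟩ˡ j)
    ; c≺b    = c≺b
    ; shares = λ α α-sorts t t≤n t≢J →
                 vertex∈F-relabel b b τ preserves {t} {t} (raise-τ t≢J) t≤n α α-sorts
    ; avoids = avoids
    }

-- The vertices k of F(b) whose opposite ridge is shared with an earlier facet.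
Removable : ∀ {m} → (Fin (suc m) → ℕ) → Fin (suc m) → Set
Removable b zero    = 1 ≤ b zero
Removable b (suc i) = b (inject₁ i) < b (suc i)

removable? : ∀ {m} (b : Fin (suc m) → ℕ) → Decidable (Removable b)
removable? b zero    = 1 ℕ.≤? b zero
removable? b (suc i) = b (inject₁ i) ℕ.<? b (suc i)

adjacent : ∀ {m q} {b : Fin (suc m) → ℕ} k → Removable b k → InS q b → Adjacent q b (toℕ k)
adjacent zero    b₀>0   = Rotation.adjacent _ b₀>0
adjacent (suc i) ascent = Transposition.adjacent _ i ascent

ShellingWitness : ∀ {n} → ℕ → (Fin n → ℕ) → (Fin n → ℕ) → Set
ShellingWitness {n} q a b =
  Σ (Fin n → ℕ) λ c → InS q c × c ≺ b ×
  Σ (Point n) λ v → v ∈F b ×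
    (∀ x → x ∈F a → x ∈F b → x ∈F c) ×
    (∀ x → (x ∈F c × x ∈F b → x ∈F b × x ≢ v) ×
           (x ∈F b × x ≢ v → x ∈F c × x ∈F b))

shellingWitness : ∀ {n q} (a b : Fin n → ℕ) {s} → s ≤ n → Avoids a b s → Adjacent q b s →
                  ShellingWitness q a b
shellingWitness a b {s} s≤n a-avoids adj with sortPerm b
... | α , α-sorts =
  c , c-inS , c≺b , v , vertex∈F b α α-sorts s≤n , a∩b⊆c , λ x → c∩b⇒b∖v x , b∖v⇒c∩b x
  where
  open Adjacent adj
  v = vertex b α s
  in-c-or-v : ∀ {x} → x ∈F b → x ∈F c ⊎ x ≡ v
  in-c-or-v x∈b with ∈F⇒vertex {a = b} x∈b
  ... | β , β-sorts , t , t≤n , x≡ with t ℕ.≟ s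
  ...   | yes refl = inj₂ (trans x≡ (vertex-unique {b = b} {β} {α} β-sorts α-sorts s))
  ...   | no  t≢s  = inj₁ (subst (_∈F c) (sym x≡) (shares β β-sorts t t≤n t≢s))
  a∩b⊆c : ∀ x → x ∈F a → x ∈F b → x ∈F c
  a∩b⊆c x x∈a x∈b with in-c-or-v x∈b
  ... | inj₁ x∈c = x∈c
  ... | inj₂ x≡v = ⊥-elim (Avoids⇒∉F {a = a} {b} {s} a-avoids α (subst (_∈F a) x≡v x∈a))
  c∩b⇒b∖v : ∀ x → x ∈F c × x ∈F b → x ∈F b × x ≢ v
  c∩b⇒b∖v x (x∈c , x∈b) =
    x∈b , λ x≡v → Avoids⇒∉F {a = c} {b} {s} avoids α (subst (_∈F c) x≡v x∈c)
  b∖v⇒c∩b : ∀ x → x ∈F b × x ≢ v → x ∈F c × x ∈F b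
  b∖v⇒c∩b x (x∈b , x≢v) with in-c-or-v x∈b
  ... | inj₁ x∈c = x∈c , x∈b
  ... | inj₂ x≡v = ⊥-elim (x≢v x≡v)

-- Choosing the ridge

Ridge : ∀ {m} → (Fin (suc m) → ℕ) → (Fin (suc m) → ℕ) → Set
Ridge a b = ∃[ k ] Removable b k × Avoids a b (toℕ k)

least-≥-removable : ∀ {m} (b : Fin (suc m) → ℕ) {M} → 1 ≤ M →
                    ∀ {k} → Least (λ j → M ≤ b j) k → Removable b k
least-≥-removable b 1≤M {zero}  (M≤b₀ , _)     = ≤-trans 1≤M M≤b₀
least-≥-removable b 1≤M {suc i} (M≤bk , below) =
  <-≤-trans (≰⇒> (below (inject₁ i) (≤-reflexive (cong suc (Finₚ.toℕ-inject₁ i))))) M≤bk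

-- φ = _∸ m(b) vanishes on every vertex of F(a), but not on the vertex of F(b) that
-- raises the first maximal entry of b.
ridge-by-max : ∀ {m} (a b : Fin (suc m) → ℕ) → mx a < mx b → Ridge a b
ridge-by-max {m} a b mx<mx
  with least (λ j → mx b ℕ.≤? b j) (let j , bj≡mx = mx-attained b in j , ≤-reflexive (sym bj≡mx))
... | k , mx≤bk , below = k , least-≥-removable b (≤-trans (s≤s z≤n) mx<mx) (mx≤bk , below) ,
  avoids-by-< a b {toℕ k} φ λ t _ → begin-strict
    stat φ a t             ≤⟨ sum-mono-≤ (λ j → ≤-reflexive (a-vanishes t j)) ⟩
    sum {suc m} (λ _ → 0)  <⟨ sum-mono-< {g = φ ∘ raise b (toℕ k)} (λ _ → z≤n) k b-survives ⟩
    stat φ b (toℕ k)       ∎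
  where
  open ≤-Reasoning
  φ : ℕ → ℕ
  φ = _∸ mx b
  a-vanishes : ∀ t j → φ (raise a t j) ≡ 0
  a-vanishes t j =
    m≤n⇒m∸n≡0 (≤-trans (+-mono-≤ (≤-mx a j) (χ≤1 t (toℕ j)))
                       (subst (_≤ mx b) (+-comm 1 (mx a)) mx<mx))
  b-survives : 0 < φ (raise b (toℕ k) k)
  b-survives = m<n⇒0<n∸m (<-≤-trans (s≤s mx≤bk) (≤-reflexive (sym raised)))
    where
    raised : raise b (toℕ k) k ≡ suc (b k)
    raised = trans (cong (b k +_) (χ-≤ (≤-refl {toℕ k}))) (+-comm (b k) 1)

-- φ = _⊔ 1 is at most a + 1 on the vertices of F(a), and equals b + 1 on the vertex of F(b)
-- that raises everything from the first nonzero entry of b on.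
ridge-by-sum : ∀ {m} (a b : Fin (suc m) → ℕ) → sum a < sum b → Ridge a b
ridge-by-sum {m} a b Σa<Σb with least? (λ j → 1 ℕ.≤? b j)
... | inj₂ b≡0 =
  ⊥-elim (<⇒≱ Σa<Σb (≤-trans (sum-mono-≤ (λ j → ≮⇒≥ (b≡0 j)))
                              (sum-mono-≤ {g = a} (λ _ → z≤n))))
... | inj₁ (k , 1≤bk , below) = k , least-≥-removable b ≤-refl (1≤bk , below) ,
  avoids-by-< a b {toℕ k} (_⊔ 1) λ t _ → begin-strict
    stat (_⊔ 1) a t        ≤⟨ sum-mono-≤ (λ j → ⊔-lub (+-monoʳ-≤ (a j) (χ≤1 t (toℕ j)))
                                                     (m≤n+m 1 (a j))) ⟩
    stat id a 0            ≡⟨ stat-id a 0 ⟩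
    sum a + suc m          <⟨ +-monoˡ-< (suc m) Σa<Σb ⟩
    sum b + suc m          ≡⟨ stat-id b 0 ⟨
    stat id b 0            ≡⟨ sum-cong-≗ b-raised ⟩
    stat (_⊔ 1) b (toℕ k)  ∎
  where
  open ≤-Reasoning
  b-raised : ∀ j → b j + 1 ≡ raise b (toℕ k) j ⊔ 1
  b-raised j with toℕ j ℕ.<? toℕ k
  ... | yes j<k rewrite n≤0⇒n≡0 (≮⇒≥ (below j j<k)) | χ-> j<k = refl
  ... | no  j≮k rewrite χ-≤ (≮⇒≥ j≮k) = sym (m≥n⇒m⊔n≡m (m≤n+m 1 (b j)))

nonincreasing : ∀ {m} (b : Fin (suc m) → ℕ) {lo j} → toℕ lo ≤ toℕ j →
                (∀ i → toℕ lo ≤ toℕ i → suc (toℕ i) ≤ toℕ j → ¬ Removable b (suc i)) → b j ≤ b lo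
nonincreasing b {lo} {j} lo≤j no-ascent with m≤n⇒m<n∨m≡n lo≤j
... | inj₂ lo≡j = ≤-reflexive (cong b (Finₚ.toℕ-injective (sym lo≡j)))
... | inj₁ lo<j = chain (λ x y → b y ≤ b x) (λ y≤x z≤y → ≤-trans z≤y y≤x) step lo<j
  where
  step : ∀ i → toℕ lo ≤ toℕ (inject₁ i) → toℕ (suc i) ≤ toℕ j → b (suc i) ≤ b (inject₁ i)
  step i lo≤i i<j = ≮⇒≥ (no-ascent i (subst (toℕ lo ≤_) (Finₚ.toℕ-inject₁ i) lo≤i) i<j)

module RevLexRidge {m} (a b : Fin (suc m) → ℕ) (Σb≡Σa : sum b ≡ sum a) (i : Fin (suc m))
                   (a≡b : ∀ j → toℕ j < toℕ i → a j ≡ b j) (bi<ai : b i < a i) where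

  LowRidge : Set
  LowRidge = ∃[ k ] Removable b k × toℕ k ≤ toℕ i

  HighAscent : Fin m → Set
  HighAscent i′ = toℕ i ≤ toℕ i′ × Removable b (suc i′)

  NoHighAscentBefore : ℕ → Set
  NoHighAscentBefore hi = ∀ i′ → HighAscent i′ → hi ≤ suc (toℕ i′)

  no-high-ascent : (∀ i′ → ¬ HighAscent i′) → NoHighAscentBefore (suc m)
  no-high-ascent none i′ high = ⊥-elim (none i′ high)

  first-high-ascent : ∀ {k} → Least HighAscent k → NoHighAscentBefore (suc (toℕ k))
  first-high-ascent (_ , below) i′ high = s≤s (≮⇒≥ λ i′<k → below i′ i′<k high)

  descending : ∀ {hi} → NoHighAscentBefore hi → ∀ j → toℕ i ≤ toℕ j → toℕ j < hi → b j ≤ b i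
  descending none-before j i≤j j<hi =
    nonincreasing b i≤j λ i′ i≤i′ i′<j ascent →
      <⇒≱ j<hi (≤-trans (none-before i′ (i≤i′ , ascent)) i′<j)

  zero-upto-i : ¬ LowRidge → ∀ j → toℕ j ≤ toℕ i → b j ≡ 0
  zero-upto-i no-low j j≤i = n≤0⇒n≡0 (≤-trans (nonincreasing b z≤n no-ascent) b₀≤0)
    where
    b₀≤0 : b zero ≤ 0
    b₀≤0 = ≮⇒≥ λ b₀>0 → no-low (zero , b₀>0 , z≤n)
    no-ascent : ∀ i′ → 0 ≤ toℕ i′ → suc (toℕ i′) ≤ toℕ j → ¬ Removable b (suc i′)
    no-ascent i′ _ i′<j ascent = no-low (suc i′ , ascent , ≤-trans i′<j j≤i)

  zero-before : ¬ LowRidge → ∀ {hi} → NoHighAscentBefore hi → ∀ j → toℕ j < hi → b j ≡ 0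
  zero-before no-low none-before j j<hi with toℕ j ℕ.≤? toℕ i
  ... | yes j≤i = zero-upto-i no-low j j≤i
  ... | no  j≰i = n≤0⇒n≡0 (≤-trans (descending none-before j (<⇒≤ (≰⇒> j≰i)) j<hi)
                                   (≤-reflexive (zero-upto-i no-low i ≤-refl)))

  agree : ∀ (f : ℕ → ℕ) t j → toℕ j < toℕ i → f (raise a t j) ≡ f (raise b t j)
  agree f t j j<i = cong (λ x → f (x + χ[ t ≤ toℕ j ])) (a≡b j j<i)

  φ : ℕ → ℕ
  φ = _∸ a i

  b-vanishes : ∀ t j → b j ≤ b i → φ (raise b t j) ≡ 0
  b-vanishes t j bj≤bi =
    m≤n⇒m∸n≡0 (≤-trans (+-mono-≤ bj≤bi (χ≤1 t (toℕ j))) (subst (_≤ a i) (+-comm 1 (b i)) bi<ai))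

  a-raised : ∀ t → t ≤ toℕ i → φ (raise a t i) ≡ 1
  a-raised t t≤i = trans (cong (λ x → φ (a i + x)) (χ-≤ t≤i)) (m+n∸m≡n (a i) 1)

  a-unraised : ∀ t → toℕ i < t → φ (raise a t i) ≡ 0
  a-unraised t i<t =
    trans (cong (λ x → φ (a i + x)) (χ-> i<t)) (trans (cong φ (+-identityʳ (a i))) (n∸n≡0 (a i)))

  -- Where b is nonincreasing from i on, φ vanishes on it, but not on a_i + 1.
  low-separates : ∀ {s} → s ≤ toℕ i → NoHighAscentBefore (suc m) → stat φ b s < stat φ a s
  low-separates {s} s≤i none-before =
    sum-mono-< b≤a i (subst₂ _<_ (sym (b-vanishes s i ≤-refl)) (sym (a-raised s s≤i)) (s≤s z≤n))
    where
    b≤a : ∀ j → φ (raise b s j) ≤ φ (raise a s j)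
    b≤a j with toℕ j ℕ.<? toℕ i
    ... | yes j<i = ≤-reflexive (sym (agree φ s j j<i))
    ... | no  j≮i =
      ≤-trans (≤-reflexive (b-vanishes s j (descending none-before j (≮⇒≥ j≮i) (Finₚ.toℕ<n j)))) z≤n

  -- The statistic changes between vertex s ≤ i and vertex k + 1 (k the first ascent of b at
  -- or after i) by more for a than for b, so it cannot agree at both.
  window-separates : ∀ {s} → s ≤ toℕ i → ∀ {k} → Least HighAscent k →
                     stat φ b s ≡ stat φ a s → stat φ b (suc (toℕ k)) ≢ stat φ a (suc (toℕ k))
  window-separates {s} s≤i {k} first@((i≤k , _) , _) same same′ = <-irrefl ΣD-equal (sum-mono-< Db≤Da i Db<Da)
    where
    s′ = suc (toℕ k)
    s≤s′ : s ≤ s′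
    s≤s′ = ≤-trans s≤i (≤-trans i≤k (n≤1+n _))
    D : (Fin (suc m) → ℕ) → Fin (suc m) → ℕ
    D y j = φ (raise y s j) ∸ φ (raise y s′ j)
    ΣD-equal : sum (D b) ≡ sum (D a)
    ΣD-equal = +-cancelˡ-≡ (stat φ b s′) _ _ (begin
      stat φ b s′ + sum (D b)  ≡⟨ stat-split (∸-monoˡ-≤ (a i)) b s≤s′ ⟨
      stat φ b s               ≡⟨ same ⟩
      stat φ a s               ≡⟨ stat-split (∸-monoˡ-≤ (a i)) a s≤s′ ⟩
      stat φ a s′ + sum (D a)  ≡⟨ cong (_+ sum (D a)) same′ ⟨
      stat φ b s′ + sum (D a)  ∎)
      where open ≡-Reasoning
    Db-zero : ∀ j → toℕ i ≤ toℕ j → D b j ≡ 0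
    Db-zero j i≤j with toℕ j ℕ.<? s′
    ... | yes j<s′ =
      trans (cong (_∸ φ (raise b s′ j)) (b-vanishes s j (descending (first-high-ascent first) j i≤j j<s′)))
            (0∸n≡0 (φ (raise b s′ j)))
    ... | no  j≮s′ =
      trans (cong₂ (λ x y → φ (b j + x) ∸ φ (b j + y)) (χ-≤ (≤-trans s≤s′ s′≤j)) (χ-≤ s′≤j))
            (n∸n≡0 (φ (b j + 1)))
      where s′≤j = ≮⇒≥ j≮s′
    Db≤Da : ∀ j → D b j ≤ D a j
    Db≤Da j with toℕ j ℕ.<? toℕ i
    ... | yes j<i = ≤-reflexive (sym (cong₂ _∸_ (agree φ s j j<i) (agree φ s′ j j<i)))
    ... | no  j≮i = ≤-trans (≤-reflexive (Db-zero j (≮⇒≥ j≮i))) z≤n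
    Db<Da : D b i < D a i
    Db<Da = subst₂ _<_ (sym (Db-zero i ≤-refl))
                       (sym (cong₂ _∸_ (a-raised s s≤i) (a-unraised s′ (s≤s i≤k)))) (s≤s z≤n)

  -- Without a low ridge b vanishes before vertex k + 1, where a_i > 0 does not.
  high-separates : ¬ LowRidge → ∀ {k} → Least HighAscent k →
                   stat (1 ∸_) a (suc (toℕ k)) < stat (1 ∸_) b (suc (toℕ k))
  high-separates no-low {k} first@((i≤k , _) , _) =
    sum-mono-< a≤b i (subst₂ _<_ (sym ai-zero) (sym (b-one i (s≤s i≤k))) (s≤s z≤n))
    where
    s′ = suc (toℕ k)
    b-one : ∀ j → toℕ j < s′ → 1 ∸ raise b s′ j ≡ 1
    b-one j j<s′ =
      cong₂ (λ x y → 1 ∸ (x + y)) (zero-before no-low (first-high-ascent first) j j<s′) (χ-> j<s′)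
    ai-zero : 1 ∸ raise a s′ i ≡ 0
    ai-zero = m≤n⇒m∸n≡0 (≤-trans (≤-<-trans z≤n bi<ai) (m≤m+n (a i) _))
    a≤b : ∀ j → 1 ∸ raise a s′ j ≤ 1 ∸ raise b s′ j
    a≤b j with toℕ j ℕ.<? toℕ i | toℕ j ℕ.<? s′
    ... | yes j<i | _        = ≤-reflexive (agree (1 ∸_) s′ j j<i)
    ... | no  _   | yes j<s′ = subst (1 ∸ raise a s′ j ≤_) (sym (b-one j j<s′)) (m∸n≤m 1 (raise a s′ j))
    ... | no  _   | no  j≮s′ = ≤-trans (≤-reflexive aj-zero) z≤n
      where
      aj-zero : 1 ∸ raise a s′ j ≡ 0
      aj-zero = trans (cong (λ x → 1 ∸ (a j + x)) (χ-≤ (≮⇒≥ j≮s′))) (m≤n⇒m∸n≡0 (m≤n+m 1 (a j)))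

  no-ridge-impossible : ¬ LowRidge → ¬ (∀ i′ → ¬ HighAscent i′)
  no-ridge-impossible no-low no-high = <-irrefl Σb≡Σa (sum-mono-< b≤a i bi<ai)
    where
    b≤a : ∀ j → b j ≤ a j
    b≤a j = subst (_≤ a j) (sym (zero-before no-low (no-high-ascent no-high) j (Finₚ.toℕ<n j))) z≤n

  ridge : Ridge a b
  ridge with Finₚ.any? (λ k → removable? b k ×-dec (toℕ k ℕ.≤? toℕ i))
           | least? (λ i′ → (toℕ i ℕ.≤? toℕ i′) ×-dec removable? b (suc i′))
  ... | yes (k , removable , k≤i) | inj₂ no-high =
    k , removable , avoids-by-≢ a b Σb≡Σa (Finₚ.toℕ≤n k) φ
                      λ same → <-irrefl same (low-separates k≤i (no-high-ascent no-high))
  ... | yes (k₀ , removable , k₀≤i) | inj₁ (k , first@((_ , ascent) , _))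
    with stat φ b (toℕ k₀) ℕ.≟ stat φ a (toℕ k₀)
  ...   | no  differ = k₀ , removable , avoids-by-≢ a b Σb≡Σa (Finₚ.toℕ≤n k₀) φ differ
  ...   | yes same   =
    suc k , ascent , avoids-by-≢ a b Σb≡Σa (Finₚ.toℕ≤n (suc k)) φ (window-separates k₀≤i first same)
  ridge | no no-low | inj₁ (k , first@((_ , ascent) , _)) =
    suc k , ascent , avoids-by-≢ a b Σb≡Σa (Finₚ.toℕ≤n (suc k)) (1 ∸_)
                       λ same → <-irrefl (sym same) (high-separates no-low first)
  ridge | no no-low | inj₂ no-high = ⊥-elim (no-ridge-impossible no-low no-high)

ridge : ∀ {m} {a b : Fin (suc m) → ℕ} → a ≺ b → Ridge a b
ridge {a = a} {b} (inj₁ mx<mx)              = ridge-by-max a b mx<mx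
ridge {a = a} {b} (inj₂ (inj₁ (_ , Sm<Sm))) = ridge-by-sum a b (subst₂ _<_ (Sm≡sum a) (Sm≡sum b) Sm<Sm)
ridge {a = a} {b} (inj₂ (inj₂ (_ , Sm≡Sm , i , a≡b , bi<ai))) =
  RevLexRidge.ridge a b (trans (sym (Sm≡sum b)) (trans (sym Sm≡Sm) (Sm≡sum a))) i a≡b bi<ai

shelling : ∀ {m} q → IsShelling {suc m} q
shelling q a b _ b-inS a≺b with ridge a≺b
... | k , removable , a-avoids = shellingWitness a b (Finₚ.toℕ≤n k) a-avoids (adjacent k removable b-inS)

mainTheorem18 : (k q : ℕ) → 2 ≤ k → 1 ≤ q →
    IsStrictTotalOrder {A = Fin (k ∸ 1) → ℕ} _≗_ _≺_ × IsShelling {k ∸ 1} q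
mainTheorem18 (suc (suc m)) q _ _ = ≺-isStrictTotalOrder , shelling q
mainTheorem18 (suc zero)    q (s≤s ()) _
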